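{- For every sequent $S$, every finite multiset $\Sigma$, every atom $p$ and every $\circ\in\{+,-\}$ there exist formulas $\forall^{\circ}_{ax}p\,S$ and $\exists^{\circ}_{ax}p\,\Sigma$ such that: (var) both are $p^{\circ}$-free, and $V^{\dagger}(\forall^{\circ}_{ax}p\,S)\subseteq V^{\dagger}(S)$ and $V^{\dagger}(\exists^{\circ}_{ax}p\,\Sigma)\subseteq V^{\dagger}(\Sigma)$ for every $\dagger\in\{+,-\}$; (i) $\Sigma\Rightarrow\exists^{\circ}_{ax}p\,\Sigma$ is derivable in $\mathbf{G4iM}$; (ii') for every sequent $\bar C\Rightarrow\bar D$ with $p\notin V^{\circ}(\bar C\Rightarrow\bar D)$, if $\Sigma,\bar C\Rightarrow\bar D$ is an axiom of $\mathbf{G4iM}$ then $\exists^{\circ}_{ax}p\,\Sigma,\bar C\Rightarrow\bar D$ is derivable in $\mathbf{G4iM}$; (iii) $S\cdot(\forall^{\circ}_{ax}p\,S\Rightarrow)$ is derivable in $\mathbf{G4iM}$; (iv') for every finite multiset $\bar C$ with $p\notin V^{\circ}(\bar C)$, if $S\cdot(\bar C\Rightarrow)$ is an axiom of $\mathbf{G4iM}$ then $\bar C\Rightarrow\forall^{\circ}_{ax}p\,S$ is derivable in $\mathbf{G4iM}$.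
   Context: Formulas are built from atoms, $\bot$, $\wedge,\vee,\to$ and $\Box$; $\top$ abbreviates $\bot\to\bot$. Positive/negative variables: $V^+(p)=\{p\}$, $V^-(p)=\varnothing$ for atoms; $V^{\pm}(\bot)=V^{\pm}(\top)=\varnothing$; $V^{\pm}(\phi\wedge\psi)=V^{\pm}(\phi\vee\psi)=V^{\pm}(\phi)\cup V^{\pm}(\psi)$; $V^+(\phi\to\psi)=V^-(\phi)\cup V^+(\psi)$, $V^-(\phi\to\psi)=V^+(\phi)\cup V^-(\psi)$; $V^{\pm}(\Box\phi)=V^{\pm}(\phi)$. For a multiset $\Gamma$, $V^{\dagger}(\Gamma)=\bigcup_{\gamma\in\Gamma}V^{\dagger}(\gamma)$. $X$ is $p^{\circ}$-free if $p\notin V^{\circ}(X)$. Sequents are $\Gamma\Rightarrow\Delta$ with $\Gamma,\Delta$ finite multisets, $\Delta$ having at most one formula; $S^a,S^s$ are antecedent and succedent. For a sequent $S$ and $\circ$ with opposite polarity $\diamond$: $V^{\circ}(S)=V^{\diamond}(S^a)\cup V^{\circ}(S^s)$. $S\cdot T$ is $(S^a\cup T^a)\Rightarrow(S^s\cup T^s)$. The axioms of $\mathbf{G4iM}$ are the sequents $\Gamma,q\Rightarrow q$ ($q$ an atom) and $\Gamma,\bot\Rightarrow\Delta$. Its rules ($\Delta$ with at most one formula): $L\wedge$, $R\wedge$, $L\vee$, $R\vee_i$, $R{\to}$ as usual; $Lp{\to}$: from $\Gamma,p,\psi\Rightarrow\Delta$ infer $\Gamma,p,p\to\psi\Rightarrow\Delta$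 ($p$ atom); $L\wedge{\to}$: from $\Gamma,\phi_1\to(\phi_2\to\psi)\Rightarrow\Delta$ infer $\Gamma,(\phi_1\wedge\phi_2)\to\psi\Rightarrow\Delta$; $L\vee{\to}$: from $\Gamma,\phi_1\to\psi,\phi_2\to\psi\Rightarrow\Delta$ infer $\Gamma,(\phi_1\vee\phi_2)\to\psi\Rightarrow\Delta$; $L{\to}{\to}$: from $\Gamma,\phi_2\to\psi\Rightarrow\phi_1\to\phi_2$ and $\Gamma,\psi\Rightarrow\Delta$ infer $\Gamma,(\phi_1\to\phi_2)\to\psi\Rightarrow\Delta$; $Lw$: from $\Gamma\Rightarrow\Delta$ infer $\Gamma,\phi\Rightarrow\Delta$; $Rw$: from $\Gamma\Rightarrow$ infer $\Gamma\Rightarrow\phi$; $M$: from $\phi\Rightarrow\psi$ infer $\Box\phi\Rightarrow\Box\psi$; $LM{\to}$: from $\phi\Rightarrow\psi$ and $\Gamma,\Box\phi,\theta\Rightarrow\Delta$ infer $\Gamma,\Box\phi,\Box\psi\to\theta\Rightarrow\Delta$. (Here $L\wedge$: from $\Gamma,\phi,\psi\Rightarrow\Delta$ infer $\Gamma,\phi\wedge\psi\Rightarrow\Delta$; $R\wedge$: from $\Gamma\Rightarrow\phi$, $\Gamma\Rightarrow\psi$ infer $\Gamma\Rightarrow\phi\wedge\psi$; $L\vee$: from $\Gamma,\phi\Rightarrow\Delta$, $\Gamma,\psi\Rightarrow\Delta$ infer $\Gamma,\phi\vee\psi\Rightarrow\Delta$; $R\vee_i$: from $\Gamma\Rightarrow\phi_i$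 infer $\Gamma\Rightarrow\phi_0\vee\phi_1$; $R{\to}$: from $\Gamma,\phi\Rightarrow\psi$ infer $\Gamma\Rightarrow\phi\to\psi$.) -}

module Defs where

open import Data.Nat using (ℕ)
open import Data.List using (List; []; _∷_; _++_)
open import Data.List.Membership.Propositional using (_∈_; _∉_)
open import Data.List.Relation.Binary.Permutation.Propositional using (_↭_)
open import Data.Maybe using (Maybe; just; nothing)
open import Data.Product using (Σ; _×_; _,_)
open import Data.Sum using (_⊎_)
open import Relation.Binary.PropositionalEquality using (_≡_)

Atom : Set
Atom = ℕ

infixr 9 _∧_
infixr 8 _∨_
infixr 7 _⇒_

data Fm : Set where
  atom : Atom → Fm
  ⊥̇    : Fm
  _∧_  : Fm → Fm → Fm
  _∨_  : Fm → Fm → Fm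
  _⇒_  : Fm → Fm → Fm
  □    : Fm → Fm

⊤̇ : Fm
⊤̇ = ⊥̇ ⇒ ⊥̇

data Pol : Set where
  pos neg : Pol

opp : Pol → Pol
opp pos = neg
opp neg = pos

V : Pol → Fm → List Atom
V pos (atom p) = p ∷ []
V neg (atom p) = []
V _ ⊥̇ = []
V o (φ ∧ ψ) = V o φ ++ V o ψ
V o (φ ∨ ψ) = V o φ ++ V o ψ
V o (φ ⇒ ψ) = V (opp o) φ ++ V o ψ
V o (□ φ) = V o φ

Vs : Pol → List Fm → List Atom
Vs o [] = []
Vs o (φ ∷ Γ) = V o φ ++ Vs o Γ

Vm : Pol → Maybe Fm → List Atom
Vm o nothing = []
Vm o (just φ) = V o φ

-- Sequents Γ ⇒ Δ, Δ at most one formula. Antecedent multisets are lists;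
-- the calculus below contains exchange (permutation), so lists are taken up to
-- permutation, i.e. as multisets.
record Sequent : Set where
  constructor _⊳_
  field
    ante : List Fm
    succ : Maybe Fm
open Sequent public

VS : Pol → Sequent → List Atom
VS o S = Vs (opp o) (ante S) ++ Vm o (succ S)

_·ante_ : Sequent → List Fm → Sequent
S ·ante C = (ante S ++ C) ⊳ succ S

infix 2 _⊢_
data _⊢_ : List Fm → Maybe Fm → Set where
  exch : ∀ {Γ Γ' Δ} → Γ ↭ Γ' → Γ ⊢ Δ → Γ' ⊢ Δ
  axAt : ∀ {Γ q} → atom q ∷ Γ ⊢ just (atom q)
  ax⊥  : ∀ {Γ Δ} → ⊥̇ ∷ Γ ⊢ Δ
  L∧   : ∀ {Γ Δ φ ψ} → φ ∷ ψ ∷ Γ ⊢ Δ → φ ∧ ψ ∷ Γ ⊢ Δ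
  R∧   : ∀ {Γ φ ψ} → Γ ⊢ just φ → Γ ⊢ just ψ → Γ ⊢ just (φ ∧ ψ)
  L∨   : ∀ {Γ Δ φ ψ} → φ ∷ Γ ⊢ Δ → ψ ∷ Γ ⊢ Δ → φ ∨ ψ ∷ Γ ⊢ Δ
  R∨₀  : ∀ {Γ φ ψ} → Γ ⊢ just φ → Γ ⊢ just (φ ∨ ψ)
  R∨₁  : ∀ {Γ φ ψ} → Γ ⊢ just ψ → Γ ⊢ just (φ ∨ ψ)
  R⇒   : ∀ {Γ φ ψ} → φ ∷ Γ ⊢ just ψ → Γ ⊢ just (φ ⇒ ψ)
  Lp⇒  : ∀ {Γ Δ p ψ} → atom p ∷ ψ ∷ Γ ⊢ Δ → atom p ∷ (atom p ⇒ ψ) ∷ Γ ⊢ Δ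
  L∧⇒  : ∀ {Γ Δ φ₁ φ₂ ψ} → (φ₁ ⇒ (φ₂ ⇒ ψ)) ∷ Γ ⊢ Δ → ((φ₁ ∧ φ₂) ⇒ ψ) ∷ Γ ⊢ Δ
  L∨⇒  : ∀ {Γ Δ φ₁ φ₂ ψ} → (φ₁ ⇒ ψ) ∷ (φ₂ ⇒ ψ) ∷ Γ ⊢ Δ → ((φ₁ ∨ φ₂) ⇒ ψ) ∷ Γ ⊢ Δ
  L⇒⇒  : ∀ {Γ Δ φ₁ φ₂ ψ} → (φ₂ ⇒ ψ) ∷ Γ ⊢ just (φ₁ ⇒ φ₂) → ψ ∷ Γ ⊢ Δ
         → ((φ₁ ⇒ φ₂) ⇒ ψ) ∷ Γ ⊢ Δ
  Lw   : ∀ {Γ Δ φ} → Γ ⊢ Δ → φ ∷ Γ ⊢ Δ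
  Rw   : ∀ {Γ φ} → Γ ⊢ nothing → Γ ⊢ just φ
  M    : ∀ {φ ψ} → φ ∷ [] ⊢ just ψ → □ φ ∷ [] ⊢ just (□ ψ)
  LM⇒  : ∀ {Γ Δ φ ψ θ} → φ ∷ [] ⊢ just ψ → □ φ ∷ θ ∷ Γ ⊢ Δ
         → □ φ ∷ (□ ψ ⇒ θ) ∷ Γ ⊢ Δ

Derivable : Sequent → Set
Derivable S = ante S ⊢ succ S

IsAxiom : Sequent → Set
IsAxiom S = (Σ Atom λ q → (atom q ∈ ante S) × (succ S ≡ just (atom q))) ⊎ (⊥̇ ∈ ante S)

_⊆_ : List Atom → List Atom → Set
xs ⊆ ys = ∀ {q} → q ∈ xs → q ∈ ys

-- Only the initial sequents of G4iM matter here, so both interpolants are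
-- read off from the atomic formulas that close a sequent.  ∃ collects, as a
-- conjunction, the p°-free atoms of Σ together with ⊥ if it occurs there:
-- any p°-free context C that closes Σ, C ⇒ D does so through one of them or
-- through C itself.  ∀ is ⊤ when S is already an axiom; otherwise it is the
-- succedent of S if that is a p°-free atom and ⊥ else, which is exactly what a
-- p°-free C needs to prove when S · (C ⇒) is an axiom.
module Submission where

open import Defs
open import Data.List using (List; []; _∷_; _++_; [_]; filter; concatMap)
open import Data.List.Membership.Propositional using (_∈_; _∉_; find; lose)
open import Data.List.Membership.Propositional.Properties
  using (∈-∃++; ∈-++⁺ʳ; ∈-filter⁺; ∈-filter⁻; ∈-concatMap⁺; ∈-concatMap⁻)
import Data.List.Membership.DecPropositional as DecMembership
open import Data.List.Relation.Unary.Any as Any using (Any; here; there; any?)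
open import Data.List.Relation.Unary.Any.Properties using (++⁺ˡ; ++⁻)
open import Data.List.Relation.Binary.Permutation.Propositional using (↭-sym; ↭-refl; swap)
open import Data.List.Relation.Binary.Permutation.Propositional.Properties using (shift)
open import Data.Maybe using (Maybe; just; nothing)
open import Data.Nat using (_≟_)
open import Data.Product using (Σ; _×_; _,_; proj₁; proj₂)
open import Data.Sum using (inj₁; inj₂)
open import Function using (_∘_)
open import Relation.Nullary using (¬_; yes; no; contradiction)
open import Relation.Nullary.Decidable using (Dec; map′; _×-dec_; ¬?)
open import Relation.Binary.PropositionalEquality using (_≡_; refl; sym; cong; subst)

open DecMembership _≟_ using (_∈?_)

private
  variable
    o d : Pol
    p x : Atom
    φ : Fm
    Γ C : List Fm
    Δ : Maybe Fm

∉-V-⊥̇ : ∀ d → x ∉ V d ⊥̇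
∉-V-⊥̇ pos ()
∉-V-⊥̇ neg ()

∉-V-⊤̇ : ∀ d → x ∉ V d ⊤̇
∉-V-⊤̇ pos ()
∉-V-⊤̇ neg ()

Vs≡concatMap : ∀ d Γ → Vs d Γ ≡ concatMap (V d) Γ
Vs≡concatMap d [] = refl
Vs≡concatMap d (φ ∷ Γ) = cong (V d φ ++_) (Vs≡concatMap d Γ)

∈-Vs⁺ : φ ∈ Γ → x ∈ V d φ → x ∈ Vs d Γ
∈-Vs⁺ {Γ = Γ} {d = d} φ∈Γ x∈φ =
  subst (_ ∈_) (sym (Vs≡concatMap d Γ)) (∈-concatMap⁺ (V d) (lose φ∈Γ x∈φ))

∈-Vs⁻ : x ∈ Vs d Γ → Σ Fm λ φ → φ ∈ Γ × x ∈ V d φ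
∈-Vs⁻ {d = d} {Γ = Γ} x∈Γ =
  find (∈-concatMap⁻ (V d) (subst (_ ∈_) (Vs≡concatMap d Γ) x∈Γ))

Vs-mono : ∀ {Γ Γ'} → (∀ {φ} → φ ∈ Γ → φ ∈ Γ') → Vs d Γ ⊆ Vs d Γ'
Vs-mono Γ⊆Γ' x∈Γ with _ , φ∈Γ , x∈φ ← ∈-Vs⁻ x∈Γ = ∈-Vs⁺ (Γ⊆Γ' φ∈Γ) x∈φ

data Closes : Fm → Maybe Fm → Set where
  closes-⊥̇    : Closes ⊥̇ Δ
  closes-atom : Closes (atom p) (just (atom p))

closes? : ∀ φ Δ → Dec (Closes φ Δ)
closes? ⊥̇ Δ = yes closes-⊥̇
closes? (atom p) nothing = no λ ()
closes? (atom p) (just (atom q)) =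
  map′ (λ { refl → closes-atom }) (λ { closes-atom → refl }) (p ≟ q)
closes? (atom p) (just ⊥̇) = no λ ()
closes? (atom p) (just (_ ∧ _)) = no λ ()
closes? (atom p) (just (_ ∨ _)) = no λ ()
closes? (atom p) (just (_ ⇒ _)) = no λ ()
closes? (atom p) (just (□ _)) = no λ ()
closes? (_ ∧ _) Δ = no λ ()
closes? (_ ∨ _) Δ = no λ ()
closes? (_ ⇒ _) Δ = no λ ()
closes? (□ _) Δ = no λ ()

Closes-self : Closes φ Δ → Closes φ (just φ)
Closes-self closes-⊥̇ = closes-⊥̇
Closes-self closes-atom = closes-atom

V-Closes : Closes φ Δ → ∀ d → V d φ ⊆ Vm d Δ
V-Closes closes-⊥̇ d x∈⊥̇ = contradiction x∈⊥̇ (∉-V-⊥̇ d)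
V-Closes closes-atom d x∈p = x∈p

Closes-⊢ : Closes φ Δ → φ ∷ Γ ⊢ Δ
Closes-⊢ closes-⊥̇ = ax⊥
Closes-⊢ closes-atom = axAt

∈-Closes-⊢ : φ ∈ Γ → Closes φ Δ → Γ ⊢ Δ
∈-Closes-⊢ φ∈Γ c with ys , zs , refl ← ∈-∃++ φ∈Γ = exch (↭-sym (shift _ ys zs)) (Closes-⊢ c)

Closed : List Fm → Maybe Fm → Set
Closed Γ Δ = Any (λ φ → Closes φ Δ) Γ

closed? : ∀ Γ Δ → Dec (Closed Γ Δ)
closed? Γ Δ = any? (λ φ → closes? φ Δ) Γ

IsAxiom⇒Closed : IsAxiom (Γ ⊳ Δ) → Closed Γ Δ
IsAxiom⇒Closed (inj₁ (_ , p∈Γ , refl)) = Any.map (λ { refl → closes-atom }) p∈Γ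
IsAxiom⇒Closed (inj₂ ⊥̇∈Γ) = Any.map (λ { refl → closes-⊥̇ }) ⊥̇∈Γ

Closed-⊢ : Closed Γ Δ → Γ ⊢ Δ
Closed-⊢ closed with _ , φ∈Γ , c ← find closed = ∈-Closes-⊢ φ∈Γ c

⊢⊤̇ : Γ ⊢ just ⊤̇
⊢⊤̇ = R⇒ ax⊥

-- Atomic formulas are exactly those that close themselves.
FreeAtomic : Pol → Atom → Fm → Set
FreeAtomic o p φ = Closes φ (just φ) × p ∉ V o φ

freeAtomic? : ∀ o p φ → Dec (FreeAtomic o p φ)
freeAtomic? o p φ = closes? φ (just φ) ×-dec ¬? (p ∈? V o φ)

freeAtomics : Pol → Atom → List Fm → List Fm
freeAtomics o p = filter (freeAtomic? o p)

⋀ : List Fm → Fm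
⋀ [] = ⊤̇
⋀ (φ ∷ Γ) = φ ∧ ⋀ Γ

V-⋀ : ∀ d Γ → V d (⋀ Γ) ≡ Vs d Γ
V-⋀ pos [] = refl
V-⋀ neg [] = refl
V-⋀ pos (φ ∷ Γ) = cong (V pos φ ++_) (V-⋀ pos Γ)
V-⋀ neg (φ ∷ Γ) = cong (V neg φ ++_) (V-⋀ neg Γ)

⋀-intro : ∀ {Φ} → (∀ {φ} → φ ∈ Φ → Γ ⊢ just φ) → Γ ⊢ just (⋀ Φ)
⋀-intro {Φ = []} _ = ⊢⊤̇
⋀-intro {Φ = φ ∷ Φ} ⊢Φ = R∧ (⊢Φ (here refl)) (⋀-intro (⊢Φ ∘ there))

⋀-elim : ∀ {Φ D} → φ ∈ Φ → φ ∷ Γ ⊢ D → ⋀ Φ ∷ Γ ⊢ D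
⋀-elim (here refl) ⊢D = L∧ (exch (swap _ _ ↭-refl) (Lw ⊢D))
⋀-elim (there φ∈Φ) ⊢D = L∧ (Lw (⋀-elim φ∈Φ ⊢D))

existsAx : Pol → Atom → List Fm → Fm
existsAx o p Σ' = ⋀ (freeAtomics o p Σ')

succedentBound : Pol → Atom → Maybe Fm → Fm
succedentBound o p nothing = ⊥̇
succedentBound o p (just φ) with freeAtomic? o p φ
... | yes _ = φ
... | no _ = ⊥̇

forallAx : Pol → Atom → Sequent → Fm
forallAx o p (Γ ⊳ Δ) with closed? Γ Δ
... | yes _ = ⊤̇
... | no _ = succedentBound o p Δ

ExistsInterpolant : Pol → Atom → List Fm → Fm → Set
ExistsInterpolant o p Σ' E =
  (p ∉ V o E) × (∀ d → V d E ⊆ Vs d Σ') × Derivable (Σ' ⊳ just E)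
  × (∀ C D → p ∉ VS o (C ⊳ D) → IsAxiom ((Σ' ++ C) ⊳ D) → Derivable ((E ∷ C) ⊳ D))

ForallInterpolant : Pol → Atom → Sequent → Fm → Set
ForallInterpolant o p S A =
  (p ∉ V o A) × (∀ d → V d A ⊆ VS d S) × Derivable (S ·ante [ A ])
  × (∀ C → p ∉ Vs o C → IsAxiom (S ·ante C) → Derivable (C ⊳ just A))

existsAx-interpolant : ∀ o p Σ' → ExistsInterpolant o p Σ' (existsAx o p Σ')
existsAx-interpolant o p Σ' = free , vars , provable , closes
  where
  kept⁻ : φ ∈ freeAtomics o p Σ' → φ ∈ Σ' × FreeAtomic o p φ
  kept⁻ = ∈-filter⁻ (freeAtomic? o p)

  free : p ∉ V o (existsAx o p Σ')
  free p∈E with _ , φ∈ , p∈φ ← ∈-Vs⁻ (subst (_ ∈_) (V-⋀ o _) p∈E) =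
    proj₂ (proj₂ (kept⁻ φ∈)) p∈φ

  vars : ∀ d → V d (existsAx o p Σ') ⊆ Vs d Σ'
  vars d = Vs-mono (proj₁ ∘ kept⁻) ∘ subst (_ ∈_) (V-⋀ d _)

  provable : Σ' ⊢ just (existsAx o p Σ')
  provable = ⋀-intro λ φ∈ → let φ∈Σ' , c , _ = kept⁻ φ∈ in ∈-Closes-⊢ φ∈Σ' c

  closes : ∀ C D → p ∉ VS o (C ⊳ D) → IsAxiom ((Σ' ++ C) ⊳ D) → existsAx o p Σ' ∷ C ⊢ D
  closes C D p∉CD ax with ++⁻ Σ' (IsAxiom⇒Closed ax)
  ... | inj₂ closedC = Lw (Closed-⊢ closedC)
  ... | inj₁ closedΣ' with φ , φ∈Σ' , c ← find closedΣ' =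
    ⋀-elim (∈-filter⁺ (freeAtomic? o p) φ∈Σ' (Closes-self c , p∉φ)) (Closes-⊢ c)
    where
    p∉φ : p ∉ V o φ
    p∉φ = p∉CD ∘ ∈-++⁺ʳ (Vs (opp o) C) ∘ V-Closes c o

succedentBound-closes : ∀ o p Δ → Closes (succedentBound o p Δ) Δ
succedentBound-closes o p nothing = closes-⊥̇
succedentBound-closes o p (just φ) with freeAtomic? o p φ
... | yes (c , _) = c
... | no _ = closes-⊥̇

succedentBound-free : ∀ o p Δ → p ∉ V o (succedentBound o p Δ)
succedentBound-free o p nothing = ∉-V-⊥̇ o
succedentBound-free o p (just φ) with freeAtomic? o p φ
... | yes (_ , p∉φ) = p∉φ
... | no _ = ∉-V-⊥̇ o

∈-Closes⇒succedentBound : p ∉ Vs o C → φ ∈ C → Closes φ Δ → C ⊢ just (succedentBound o p Δ)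
∈-Closes⇒succedentBound p∉C φ∈C closes-⊥̇ = ∈-Closes-⊢ φ∈C closes-⊥̇
∈-Closes⇒succedentBound {p = p} {o = o} {φ = φ} p∉C φ∈C closes-atom with freeAtomic? o p φ
... | yes _ = ∈-Closes-⊢ φ∈C closes-atom
... | no ¬free = contradiction (closes-atom , p∉C ∘ ∈-Vs⁺ φ∈C) ¬free

⊤̇-interpolant : Closed Γ Δ → ForallInterpolant o p (Γ ⊳ Δ) ⊤̇
⊤̇-interpolant {o = o} closed =
  ∉-V-⊤̇ o , (λ d x∈⊤̇ → contradiction x∈⊤̇ (∉-V-⊤̇ d)) , Closed-⊢ (++⁺ˡ closed) , λ _ _ _ → ⊢⊤̇

succedentBound-interpolant : ¬ Closed Γ Δ → ForallInterpolant o p (Γ ⊳ Δ) (succedentBound o p Δ)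
succedentBound-interpolant {Γ = Γ} {Δ = Δ} {o = o} {p = p} ¬closed =
  succedentBound-free o p Δ , vars ,
  ∈-Closes-⊢ (∈-++⁺ʳ Γ (here refl)) closes , provable
  where
  closes : Closes (succedentBound o p Δ) Δ
  closes = succedentBound-closes o p Δ

  vars : ∀ d → V d (succedentBound o p Δ) ⊆ VS d (Γ ⊳ Δ)
  vars d = ∈-++⁺ʳ (Vs (opp d) Γ) ∘ V-Closes closes d

  provable : ∀ C → p ∉ Vs o C → IsAxiom ((Γ ++ C) ⊳ Δ) → C ⊢ just (succedentBound o p Δ)
  provable C p∉C ax with ++⁻ Γ (IsAxiom⇒Closed ax)
  ... | inj₁ closedΓ = contradiction closedΓ ¬closed
  ... | inj₂ closedC with _ , φ∈C , c ← find closedC = ∈-Closes⇒succedentBound p∉C φ∈C c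

forallAx-interpolant : ∀ o p S → ForallInterpolant o p S (forallAx o p S)
forallAx-interpolant o p (Γ ⊳ Δ) with closed? Γ Δ
... | yes closed = ⊤̇-interpolant closed
... | no ¬closed = succedentBound-interpolant ¬closed

lemma4p3 : (S : Sequent) (Σ' : List Fm) (p : Atom) (o : Pol) →
    Σ Fm λ A → Σ Fm λ E →
      ((p ∉ V o A) × (p ∉ V o E)
        × (∀ d → V d A ⊆ VS d S)
        × (∀ d → V d E ⊆ Vs d Σ'))
      × Derivable (Σ' ⊳ just E)
      × (∀ (C : List Fm) (D : Maybe Fm) → p ∉ VS o (C ⊳ D)
           → IsAxiom ((Σ' ++ C) ⊳ D) → Derivable ((E ∷ C) ⊳ D))
      × Derivable (S ·ante (A ∷ []))
      × (∀ (C : List Fm) → p ∉ Vs o C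
           → IsAxiom (S ·ante C) → Derivable (C ⊳ just A))
lemma4p3 S Σ' p o =
  let A-free , A-vars , A-iii , A-iv = forallAx-interpolant o p S
      E-free , E-vars , E-i , E-ii = existsAx-interpolant o p Σ'
  in forallAx o p S , existsAx o p Σ' ,
     (A-free , E-free , A-vars , E-vars) , E-i , E-ii , A-iii , A-iv
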